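{- Let $\tau_1,\tau_2\in\Omega_\infty$ with $\phi_0(\tau_1)=1$, and suppose that the image of $\tau_2$ in $\Omega_\infty/[\Omega_\infty,\Omega_\infty]$ is neither the image of $\tau_1$ nor the identity. Then $\tau_1$ and $\tau_2$ do not commute.
   Context: $\Omega_\infty$: profinite automorphism group of the rooted binary tree $T_\infty$ (Cayley graph of the free monoid on $\{x,y\}$, word $w$ joined to $xw,yw$; $L_i$ = words of length $i$). For a word $w$, $\sigma_w$ is the involution fixing words not ending in $w$ and sending $v'w\mapsto\overline{v'}w$ ($x,y$ swapped in $v'$); each $\sigma$ is uniquely $\lim_N\sigma_N\cdots\sigma_0$ with $\sigma_i=\prod_{w\in L_i}\sigma_w^{\varepsilon_w(\sigma)}$, and $\phi_0(\sigma)=\varepsilon_e(\sigma)$, i.e. $\phi_0(\sigma)=1$ iff $\sigma$ swaps the two vertices $x$ and $y$ of level one. $[\Omega_\infty,\Omega_\infty]$ is the closed commutator subgroup. -}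

module Defs where

open import Data.Bool using (Bool; true; false)
open import Data.List using (List; []; _∷_; length; foldr)
open import Data.Nat using (ℕ; _≤_)
open import Data.Product using (Σ; _×_; _,_; ∃)
open import Relation.Binary.PropositionalEquality using (_≡_)
open import Relation.Nullary using (¬_)

-- Letters: x = false, y = true.  Words of T∞ are lists of letters; the
-- word w is joined to x w = false ∷ w and y w = true ∷ w (level = length).
Letter : Set
Letter = Bool

x y : Letter
x = false
y = true

Word : Set
Word = List Letter

-- An automorphism is a
-- bijection of the vertex set (given with its inverse) fixing the root and
-- preserving the edge relation w — a w, i.e. it maps the children of w to
-- children of its image.
record Ω∞ : Set where
  field
    act      : Word → Word
    inv      : Word → Word
    act-inv  : ∀ w → act (inv w) ≡ w
    inv-act  : ∀ w → inv (act w) ≡ w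
    act-root : act [] ≡ []
    act-edge : ∀ (a : Letter) (w : Word) → Σ Letter λ b → act (a ∷ w) ≡ b ∷ act w
open Ω∞ public

Map : Set
Map = Word → Word

idMap : Map
idMap w = w

_∘ₘ_ : Map → Map → Map
(f ∘ₘ g) w = f (g w)

commutator : Ω∞ → Ω∞ → Map
commutator a b = act a ∘ₘ (act b ∘ₘ (inv a ∘ₘ inv b))

-- product of a finite list of commutators (an arbitrary element of the
-- abstract commutator subgroup [Ω∞,Ω∞], which is generated by commutators
-- and closed under inverses since [a,b]⁻¹ = [b,a]).
prodComm : List (Ω∞ × Ω∞) → Map
prodComm = foldr (λ { (a , b) f → commutator a b ∘ₘ f }) idMap

AgreeUpTo : ℕ → Map → Map → Set
AgreeUpTo n f g = ∀ (w : Word) → length w ≤ n → f w ≡ g w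

-- Membership of (the map of) an element in the closed commutator subgroup:
-- every basic open neighbourhood (elements agreeing up to level n) meets
-- the commutator subgroup.
InClosedComm : Map → Set
InClosedComm f = ∀ (n : ℕ) → ∃ λ (cs : List (Ω∞ × Ω∞)) → AgreeUpTo n f (prodComm cs)

SameAbImage : Ω∞ → Ω∞ → Set
SameAbImage σ τ = InClosedComm (act σ ∘ₘ inv τ)

TrivialAbImage : Ω∞ → Set
TrivialAbImage σ = InClosedComm (act σ)

-- φ₀(σ) = 1  iff σ swaps the level-one vertices x and y
φ₀≡1 : Ω∞ → Set
φ₀≡1 σ = act σ (x ∷ []) ≡ y ∷ []

Commute : Ω∞ → Ω∞ → Set
Commute σ τ = ∀ (w : Word) → act σ (act τ w) ≡ act τ (act σ w)

{-# OPTIONS --safe #-}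
module Submission where

-- Let t swap the subtrees at x s and y s, and let g be supported at s, fix x s
-- and commute with t.  With h the restriction of g to the subtree at x s,
-- g = h · t⁻¹ h t = h² · [h⁻¹ , t⁻¹], so g ≡ h² modulo commutators.  Squares
-- of automorphisms supported at s are commutator products to any depth, by
-- induction on the depth: if u fixes x s, then u² is the product of the
-- squares of its restrictions to the subtrees at x s and y s; if u swaps them,
-- then u² fixes x s and commutes with u, so the first observation applies.
-- Hence any automorphism fixing x and commuting with τ₁ lies in the closed
-- commutator subgroup; apply this to τ₂ or to τ₂ τ₁⁻¹.

open import Defs
open import Data.Bool using (true; false; not; if_then_else_)
open import Data.Bool.Properties using (¬-not; not-¬) renaming (_≟_ to _≟ᴸ_)
open import Data.Empty using (⊥-elim)
open import Data.List using (List; []; _∷_; _++_; length)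
open import Data.List.Properties using (≡-dec; ∷-injectiveˡ; ∷-injectiveʳ)
open import Data.Nat using (ℕ; zero; suc; _+_; _≤_)
open import Data.Nat.Properties using (≤-refl; ≤-trans; ≤-reflexive; m≤n⇒m≤1+n; n≤1+n; 1+n≰n; +-suc; +-identityʳ)
open import Data.Product using (Σ; _×_; _,_)
open import Data.Sum using (_⊎_; inj₁; inj₂)
open import Function using (_∘_)
open import Relation.Nullary using (¬_; Dec; yes; no; does; contradiction)
open import Relation.Nullary.Decidable using (dec-true; dec-false)
open import Relation.Binary.PropositionalEquality
open ≡-Reasoning

_≟ᵂ_ : (u v : Word) → Dec (u ≡ v)
_≟ᵂ_ = ≡-dec _≟ᴸ_

inv-root : (σ : Ω∞) → inv σ [] ≡ []
inv-root σ = trans (cong (inv σ) (sym (act-root σ))) (inv-act σ [])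

act≡⇒inv≡ : (σ : Ω∞) {u v : Word} → act σ u ≡ v → inv σ v ≡ u
act≡⇒inv≡ σ {u} σu≡v = trans (cong (inv σ) (sym σu≡v)) (inv-act σ u)

act-injective : (σ : Ω∞) {u v : Word} → act σ u ≡ act σ v → u ≡ v
act-injective σ {u} {v} σu≡σv = trans (sym (act≡⇒inv≡ σ σu≡σv)) (inv-act σ v)

inv-edge : (σ : Ω∞) (a : Letter) (w : Word) → Σ Letter λ b → inv σ (a ∷ w) ≡ b ∷ inv σ w
inv-edge σ a w with inv σ (a ∷ w) | act-inv σ (a ∷ w)
... | [] | σ[]≡aw with () ← trans (sym (act-root σ)) σ[]≡aw
... | c ∷ v | σcv≡aw with act-edge σ c v
...   | _ , σcv≡dσv = c , cong (c ∷_) (sym (act≡⇒inv≡ σ (∷-injectiveʳ (trans (sym σcv≡dσv) σcv≡aw))))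

infix  10 _⁻¹
infixr 9 _∘Ω_

_⁻¹ : Ω∞ → Ω∞
σ ⁻¹ = record
  { act = inv σ ; inv = act σ ; act-inv = inv-act σ ; inv-act = act-inv σ
  ; act-root = inv-root σ ; act-edge = inv-edge σ }

_∘Ω_ : Ω∞ → Ω∞ → Ω∞
σ ∘Ω τ = record
  { act = act σ ∘ₘ act τ ; inv = inv τ ∘ₘ inv σ
  ; act-inv = λ w → trans (cong (act σ) (act-inv τ (inv σ w))) (act-inv σ w)
  ; inv-act = λ w → trans (cong (inv τ) (inv-act σ (act τ w))) (inv-act τ w)
  ; act-root = trans (cong (act σ) (act-root τ)) (act-root σ)
  ; act-edge = edge }
  where
  edge : (a : Letter) (w : Word) → Σ Letter λ c → act σ (act τ (a ∷ w)) ≡ c ∷ act σ (act τ w)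
  edge a w with act-edge τ a w
  ... | b , τaw with act-edge σ b (act τ w)
  ...   | c , σbτw = c , trans (cong (act σ) τaw) σbτw

act-length : (σ : Ω∞) (w : Word) → length (act σ w) ≡ length w
act-length σ [] = cong length (act-root σ)
act-length σ (a ∷ w) with act-edge σ a w
... | _ , σaw = trans (cong length σaw) (cong suc (act-length σ w))

act-child-of-fixed : (σ : Ω∞) {s : Word} → act σ s ≡ s → (a : Letter) → Σ Letter λ b → act σ (a ∷ s) ≡ b ∷ s
act-child-of-fixed σ {s} σs a with act-edge σ a s
... | b , σas = b , trans σas (cong (b ∷_) σs)

act-sibling : (σ : Ω∞) {s : Word} {a b : Letter} → act σ s ≡ s → act σ (a ∷ s) ≡ b ∷ s → act σ (not a ∷ s) ≡ not b ∷ s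
act-sibling σ {s} {a} {b} σs σas with act-child-of-fixed σ σs (not a)
... | c , σnas with c ≟ᴸ b
...   | yes refl = ⊥-elim (not-¬ refl (sym (∷-injectiveˡ (act-injective σ (trans σnas (sym σas))))))
...   | no c≢b = trans σnas (cong (_∷ s) (¬-not c≢b))

Commute-∘⁻¹ : (t g : Ω∞) → Commute t g → Commute t (g ∘Ω t ⁻¹)
Commute-∘⁻¹ t g tg w = begin
  act t (act g (inv t w))  ≡⟨ tg (inv t w) ⟩
  act g (act t (inv t w))  ≡⟨ cong (act g) (act-inv t w) ⟩
  act g w                  ≡⟨ cong (act g) (sym (inv-act t w)) ⟩
  act g (inv t (act t w))  ∎

data InSubtree (s : Word) : Word → Set where
  here  : InSubtree s s
  there : ∀ {a w} → InSubtree s w → InSubtree s (a ∷ w)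

subtree-[] : ∀ w → InSubtree [] w
subtree-[] []      = here
subtree-[] (a ∷ w) = there (subtree-[] w)

subtree-length : ∀ {s w} → InSubtree s w → length s ≤ length w
subtree-length here      = ≤-refl
subtree-length (there e) = m≤n⇒m≤1+n (subtree-length e)

subtree? : (s w : Word) → Dec (InSubtree s w)
subtree? s w with w ≟ᵂ s
... | yes refl = yes here
subtree? s []      | no w≢s = no λ { here → w≢s refl }
subtree? s (a ∷ w) | no w≢s with subtree? s w
... | yes e = yes (there e)
... | no ¬e = no λ { here → w≢s refl ; (there e) → ¬e e }

root-or-child : ∀ {s w} → InSubtree s w → w ≡ s ⊎ Σ Letter λ a → InSubtree (a ∷ s) w
root-or-child here = inj₁ refl
root-or-child (there {a} e) with root-or-child e
... | inj₁ refl     = inj₂ (a , here)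
... | inj₂ (b , e') = inj₂ (b , there e')

subtree-unique : ∀ {p q w} → InSubtree p w → InSubtree q w → length p ≡ length q → p ≡ q
subtree-unique here      here       _  = refl
subtree-unique here      (there e)  pq = ⊥-elim (1+n≰n (≤-trans (≤-reflexive pq) (subtree-length e)))
subtree-unique (there e) here       pq = ⊥-elim (1+n≰n (≤-trans (≤-reflexive (sym pq)) (subtree-length e)))
subtree-unique (there e) (there e') pq = subtree-unique e e' pq

siblings-disjoint : ∀ {a s w} → InSubtree (a ∷ s) w → ¬ InSubtree (not a ∷ s) w
siblings-disjoint e e' = not-¬ refl (∷-injectiveˡ (subtree-unique e e' refl))

act-subtree : (σ : Ω∞) {s s' w : Word} → act σ s ≡ s' → InSubtree s w → InSubtree s' (act σ w)
act-subtree σ refl here = here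
act-subtree σ σs (there {a} {w} e) with act-edge σ a w
... | _ , σaw rewrite σaw = there (act-subtree σ σs e)

data ChildPosition (s w : Word) : Set where
  in-child     : (a : Letter) → InSubtree (a ∷ s) w → ChildPosition s w
  off-children : (∀ a → ¬ InSubtree (a ∷ s) w) → ChildPosition s w

child-position : (s w : Word) → ChildPosition s w
child-position s w with subtree? (x ∷ s) w | subtree? (y ∷ s) w
... | yes e | _     = in-child x e
... | no _  | yes e = in-child y e
... | no ¬x | no ¬y = off-children λ { false → ¬x ; true → ¬y }

record SupportedAt (s : Word) (σ : Ω∞) : Set where
  field
    fixes-root    : act σ s ≡ s
    fixes-outside : ∀ {w} → ¬ InSubtree s w → act σ w ≡ w
open SupportedAt

supported-[] : (σ : Ω∞) → SupportedAt [] σ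
supported-[] σ = record { fixes-root = act-root σ ; fixes-outside = λ {w} ∉ → contradiction (subtree-[] w) ∉ }

fixes-off-children : ∀ {s w σ} → SupportedAt s σ → (∀ a → ¬ InSubtree (a ∷ s) w) → act σ w ≡ w
fixes-off-children {s} {w} σ-supp ∉children with subtree? s w
... | no ∉ = fixes-outside σ-supp ∉
... | yes e with root-or-child e
...   | inj₁ refl    = fixes-root σ-supp
...   | inj₂ (a , e') = contradiction e' (∉children a)

inside : Word → Map → Map
inside p f w = if does (subtree? p w) then f w else w

inside-∈ : ∀ {p w} (f : Map) → InSubtree p w → inside p f w ≡ f w
inside-∈ {p} {w} f e = cong (if_then f w else w) (dec-true (subtree? p w) e)

inside-∉ : ∀ {p w} (f : Map) → ¬ InSubtree p w → inside p f w ≡ w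
inside-∉ {p} {w} f ∉ = cong (if_then f w else w) (dec-false (subtree? p w) ∉)

-- Case splits on subtree? go through an explicit Dec argument: a `with` would
-- normalise the goal and abstract the decision hidden inside `inside`.
inside-cancel : ∀ {p} (σ : Ω∞) (f : Map) → act σ p ≡ p → (∀ w → f (act σ w) ≡ w)
              → ∀ w → inside p f (inside p (act σ) w) ≡ w
inside-cancel {p} σ f σp cancel w = by-cases (subtree? p w)
  where
  by-cases : Dec (InSubtree p w) → inside p f (inside p (act σ) w) ≡ w
  by-cases (yes e) = trans (cong (inside p f) (inside-∈ (act σ) e)) (trans (inside-∈ f (act-subtree σ σp e)) (cancel w))
  by-cases (no ∉)  = trans (cong (inside p f) (inside-∉ (act σ) ∉)) (inside-∉ f ∉)

module Restriction (p : Word) (g : Ω∞) (gp : act g p ≡ p) where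

  private
    ract : Map
    ract = inside p (act g)

    root : Dec (InSubtree p []) → ract [] ≡ []
    root (yes e) = trans (inside-∈ (act g) e) (act-root g)
    root (no ∉)  = inside-∉ (act g) ∉

    edge : (a : Letter) (w : Word) → Dec (InSubtree p w) → Dec (InSubtree p (a ∷ w))
         → Σ Letter λ b → ract (a ∷ w) ≡ b ∷ ract w
    edge a w (yes e) _ with act-edge g a w
    ... | b , gaw = b , trans (inside-∈ (act g) (there e)) (trans gaw (cong (b ∷_) (sym (inside-∈ (act g) e))))
    edge a w (no ∉) (yes here)      = a , trans (inside-∈ (act g) here) (trans gp (cong (a ∷_) (sym (inside-∉ (act g) ∉))))
    edge a w (no ∉) (yes (there e)) = contradiction e ∉
    edge a w (no ∉) (no ∉a)         = a , trans (inside-∉ (act g) ∉a) (cong (a ∷_) (sym (inside-∉ (act g) ∉)))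

  restrict : Ω∞
  restrict = record
    { act = ract ; inv = inside p (inv g)
    ; act-inv = inside-cancel (g ⁻¹) (act g) (act≡⇒inv≡ g gp) (act-inv g)
    ; inv-act = inside-cancel g (inv g) gp (inv-act g)
    ; act-root = root (subtree? p [])
    ; act-edge = λ a w → edge a w (subtree? p w) (subtree? p (a ∷ w)) }

  restrict-∈ : ∀ {w} → InSubtree p w → act restrict w ≡ act g w
  restrict-∈ = inside-∈ (act g)

  restrict-∉ : ∀ {w} → ¬ InSubtree p w → act restrict w ≡ w
  restrict-∉ = inside-∉ (act g)

  restrict-supported : SupportedAt p restrict
  restrict-supported = record { fixes-root = trans (restrict-∈ here) gp ; fixes-outside = restrict-∉ }

open Restriction using (restrict; restrict-∈; restrict-∉; restrict-supported)

CommApprox : ℕ → Map → Set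
CommApprox n f = Σ (List (Ω∞ × Ω∞)) λ cs → AgreeUpTo n f (prodComm cs)

prodComm-++ : ∀ cs ds w → prodComm (cs ++ ds) w ≡ prodComm cs (prodComm ds w)
prodComm-++ []             ds w = refl
prodComm-++ ((a , b) ∷ cs) ds w = cong (commutator a b) (prodComm-++ cs ds w)

approx-commutator : ∀ {n} (a b : Ω∞) → CommApprox n (commutator a b)
approx-commutator a b = (a , b) ∷ [] , λ _ _ → refl

approx-∘ : ∀ {n} {f : Map} (σ : Ω∞) → CommApprox n f → CommApprox n (act σ) → CommApprox n (f ∘ₘ act σ)
approx-∘ {f = f} σ (cs , f≈cs) (ds , σ≈ds) = cs ++ ds , λ w lw → begin
  f (act σ w)               ≡⟨ f≈cs (act σ w) (subst (_≤ _) (sym (act-length σ w)) lw) ⟩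
  prodComm cs (act σ w)     ≡⟨ cong (prodComm cs) (σ≈ds w lw) ⟩
  prodComm cs (prodComm ds w) ≡⟨ prodComm-++ cs ds w ⟨
  prodComm (cs ++ ds) w     ∎

approx-resp-≗ : ∀ {n} {f f' : Map} → f ≗ f' → CommApprox n f → CommApprox n f'
approx-resp-≗ f≗f' (cs , f≈cs) = cs , λ w lw → trans (sym (f≗f' w)) (f≈cs w lw)

approx-mono : ∀ {m n} {f : Map} → n ≤ m → CommApprox m f → CommApprox n f
approx-mono n≤m (cs , f≈cs) = cs , λ w lw → f≈cs w (≤-trans lw n≤m)

module HalfRestriction (s : Word) (t g : Ω∞) (t-supp : SupportedAt s t) (g-supp : SupportedAt s g)
                       (t-swaps : act t (x ∷ s) ≡ y ∷ s) (g-fixes : act g (x ∷ s) ≡ x ∷ s)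
                       (t∘g : Commute t g) where

  h : Ω∞
  h = restrict (x ∷ s) g g-fixes

  g≗h∘t⁻¹∘h∘t : act g ≗ act (h ∘Ω t ⁻¹ ∘Ω h ∘Ω t)
  g≗h∘t⁻¹∘h∘t w with child-position s w
  ... | off-children ∉ = begin
    act g w                        ≡⟨ fixes-off-children g-supp ∉ ⟩
    w                              ≡⟨ restrict-∉ (x ∷ s) g g-fixes (∉ x) ⟨
    act h w                        ≡⟨ cong (act h) (act≡⇒inv≡ t tw≡w) ⟨
    act h (inv t w)                ≡⟨ cong (act h ∘ inv t) (restrict-∉ (x ∷ s) g g-fixes (∉ x)) ⟨
    act h (inv t (act h w))        ≡⟨ cong (act h ∘ inv t ∘ act h) tw≡w ⟨
    act h (inv t (act h (act t w))) ∎
    where tw≡w = fixes-off-children t-supp ∉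
  ... | in-child false e = begin
    act g w                        ≡⟨ restrict-∈ (x ∷ s) g g-fixes e ⟨
    act h w                        ≡⟨ cong (act h) (inv-act t w) ⟨
    act h (inv t (act t w))        ≡⟨ cong (act h ∘ inv t) (restrict-∉ (x ∷ s) g g-fixes (siblings-disjoint tw∈y)) ⟨
    act h (inv t (act h (act t w))) ∎
    where tw∈y = act-subtree t t-swaps e
  ... | in-child true e = begin
    act g w                        ≡⟨ restrict-∉ (x ∷ s) g g-fixes (siblings-disjoint gw∈y) ⟨
    act h (act g w)                ≡⟨ cong (act h) (inv-act t (act g w)) ⟨
    act h (inv t (act t (act g w))) ≡⟨ cong (act h ∘ inv t) (t∘g w) ⟩
    act h (inv t (act g (act t w))) ≡⟨ cong (act h ∘ inv t) (restrict-∈ (x ∷ s) g g-fixes tw∈x) ⟨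
    act h (inv t (act h (act t w))) ∎
    where
    tw∈x = act-subtree t (act-sibling t (fixes-root t-supp) t-swaps) e
    gw∈y = act-subtree g (act-sibling g (fixes-root g-supp) g-fixes) e

  approx-from-square : ∀ n → CommApprox n (act (h ∘Ω h)) → CommApprox n (act g)
  approx-from-square n h² =
    approx-resp-≗ h²[h⁻¹,t⁻¹]≗g (approx-∘ (h ⁻¹ ∘Ω t ⁻¹ ∘Ω h ∘Ω t) h² (approx-commutator (h ⁻¹) (t ⁻¹)))
    where
    h²[h⁻¹,t⁻¹]≗g : act (h ∘Ω h ∘Ω h ⁻¹ ∘Ω t ⁻¹ ∘Ω h ∘Ω t) ≗ act g
    h²[h⁻¹,t⁻¹]≗g w = trans (cong (act h) (act-inv h (inv t (act h (act t w))))) (sym (g≗h∘t⁻¹∘h∘t w))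

fixed-twice : (σ : Ω∞) {w : Word} → act σ w ≡ w → act σ (act σ w) ≡ w
fixed-twice σ σw = trans (cong (act σ) σw) σw

square-supported : ∀ {s σ} → SupportedAt s σ → SupportedAt s (σ ∘Ω σ)
square-supported {σ = σ} σ-supp = record
  { fixes-root    = fixed-twice σ (fixes-root σ-supp)
  ; fixes-outside = λ ∉ → fixed-twice σ (fixes-outside σ-supp ∉) }

module ChildRestrictions (s : Word) (u : Ω∞) (u-supp : SupportedAt s u) (u-fixes-x : act u (x ∷ s) ≡ x ∷ s) where

  u-fixes-y : act u (y ∷ s) ≡ y ∷ s
  u-fixes-y = act-sibling u (fixes-root u-supp) u-fixes-x

  uₓ uᵧ : Ω∞
  uₓ = restrict (x ∷ s) u u-fixes-x
  uᵧ = restrict (y ∷ s) u u-fixes-y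

  square-split : act (uₓ ∘Ω uₓ ∘Ω uᵧ ∘Ω uᵧ) ≗ act (u ∘Ω u)
  square-split w with child-position s w
  ... | off-children ∉ = begin
    act uₓ (act uₓ (act uᵧ (act uᵧ w))) ≡⟨ cong (act uₓ ∘ act uₓ) (fixed-twice uᵧ (restrict-∉ (y ∷ s) u u-fixes-y (∉ y))) ⟩
    act uₓ (act uₓ w)                   ≡⟨ fixed-twice uₓ (restrict-∉ (x ∷ s) u u-fixes-x (∉ x)) ⟩
    w                                   ≡⟨ fixed-twice u (fixes-off-children u-supp ∉) ⟨
    act u (act u w)                     ∎
  ... | in-child false e = begin
    act uₓ (act uₓ (act uᵧ (act uᵧ w))) ≡⟨ cong (act uₓ ∘ act uₓ) (fixed-twice uᵧ (restrict-∉ (y ∷ s) u u-fixes-y (siblings-disjoint e))) ⟩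
    act uₓ (act uₓ w)                   ≡⟨ cong (act uₓ) (restrict-∈ (x ∷ s) u u-fixes-x e) ⟩
    act uₓ (act u w)                    ≡⟨ restrict-∈ (x ∷ s) u u-fixes-x (act-subtree u u-fixes-x e) ⟩
    act u (act u w)                     ∎
  ... | in-child true e = begin
    act uₓ (act uₓ (act uᵧ (act uᵧ w))) ≡⟨ cong (act uₓ ∘ act uₓ) uᵧ²w≡u²w ⟩
    act uₓ (act uₓ (act u (act u w)))   ≡⟨ fixed-twice uₓ (restrict-∉ (x ∷ s) u u-fixes-x (siblings-disjoint u²w∈y)) ⟩
    act u (act u w)                     ∎
    where
    uw∈y = act-subtree u u-fixes-y e
    u²w∈y = act-subtree u u-fixes-y uw∈y
    uᵧ²w≡u²w : act uᵧ (act uᵧ w) ≡ act u (act u w)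
    uᵧ²w≡u²w = trans (cong (act uᵧ) (restrict-∈ (y ∷ s) u u-fixes-y e)) (restrict-∈ (y ∷ s) u u-fixes-y uw∈y)

square-approx : ∀ k s (u : Ω∞) → SupportedAt s u → CommApprox (length s + k) (act (u ∘Ω u))
square-approx zero s u u-supp rewrite +-identityʳ (length s) = [] , u²-fixes-level
  where
  u²-fixes-level : ∀ w → length w ≤ length s → act u (act u w) ≡ w
  u²-fixes-level w lw with child-position s w
  ... | in-child _ e   = contradiction (≤-trans (subtree-length e) lw) 1+n≰n
  ... | off-children ∉ = fixed-twice u (fixes-off-children u-supp ∉)
square-approx (suc k) s u u-supp rewrite +-suc (length s) k with act-child-of-fixed u (fixes-root u-supp) x
... | false , u-fixes-x =
  approx-resp-≗ square-split
    (approx-∘ (uᵧ ∘Ω uᵧ) (square-approx k (x ∷ s) uₓ (restrict-supported (x ∷ s) u u-fixes-x))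
                         (square-approx k (y ∷ s) uᵧ (restrict-supported (y ∷ s) u u-fixes-y)))
  where open ChildRestrictions s u u-supp u-fixes-x
... | true , u-swaps-x =
  approx-from-square _ (square-approx k (x ∷ s) h (restrict-supported (x ∷ s) (u ∘Ω u) u²-fixes-x))
  where
  u²-fixes-x : act u (act u (x ∷ s)) ≡ x ∷ s
  u²-fixes-x = trans (cong (act u) u-swaps-x) (act-sibling u (fixes-root u-supp) u-swaps-x)
  open HalfRestriction s u (u ∘Ω u) u-supp (square-supported u-supp) u-swaps-x u²-fixes-x (λ _ → refl)

commutes-with-swap⇒inClosedComm : (t g : Ω∞) → act t (x ∷ []) ≡ y ∷ [] → act g (x ∷ []) ≡ x ∷ []
                                  → Commute t g → InClosedComm (act g)
commutes-with-swap⇒inClosedComm t g t-swaps g-fixes t∘g n =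
  approx-from-square n (approx-mono (n≤1+n n) (square-approx n (x ∷ []) h (restrict-supported (x ∷ []) g g-fixes)))
  where open HalfRestriction [] t g (supported-[] t) (supported-[] g) t-swaps g-fixes t∘g

proposition7p3 : (τ₁ τ₂ : Ω∞) → φ₀≡1 τ₁ → ¬ SameAbImage τ₂ τ₁ → ¬ TrivialAbImage τ₂ → ¬ Commute τ₁ τ₂
proposition7p3 τ₁ τ₂ τ₁-swaps τ₂≢τ₁ τ₂≢1 τ₁∘τ₂ with act-child-of-fixed τ₂ (act-root τ₂) x
... | false , τ₂-fixes =
  τ₂≢1 (commutes-with-swap⇒inClosedComm τ₁ τ₂ τ₁-swaps τ₂-fixes τ₁∘τ₂)
... | true , τ₂-swaps =
  τ₂≢τ₁ (commutes-with-swap⇒inClosedComm τ₁ (τ₂ ∘Ω τ₁ ⁻¹) τ₁-swaps τ₂τ₁⁻¹-fixes (Commute-∘⁻¹ τ₁ τ₂ τ₁∘τ₂))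
  where
  τ₂τ₁⁻¹-fixes : act τ₂ (inv τ₁ (x ∷ [])) ≡ x ∷ []
  τ₂τ₁⁻¹-fixes = begin
    act τ₂ (inv τ₁ (x ∷ [])) ≡⟨ cong (act τ₂) (act≡⇒inv≡ τ₁ (act-sibling τ₁ (act-root τ₁) τ₁-swaps)) ⟩
    act τ₂ (y ∷ [])          ≡⟨ act-sibling τ₂ (act-root τ₂) τ₂-swaps ⟩
    x ∷ []                   ∎
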